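{- Let $G$ be a graph. Then $G$ is precedence proper $2$-thin if and only if there exist orderings $s_1,s_2$ of two sets $V(s_1),V(s_2)$ forming a bipartition $(V(s_1),V(s_2))$ of $V(G)$ such that the concatenation $s=s_1s_2$ is strongly consistent with this bipartition and $(s_1,s_2)$ is strongly in accordance with $G$.
   Context: An ordering $s$ of $V(G)$ is consistent with a partition if for every triple $p,q,r$ with $p$ before $q$ before $r$ in $s$, whenever $p,q$ lie in the same part and $(p,r)\in E(G)$, then $(q,r)\in E(G)$; it is strongly consistent if additionally, whenever $q,r$ lie in the same part and $(p,r)\in E(G)$, then $(p,q)\in E(G)$. $G$ is precedence proper $k$-thin if there is a partition of $V(G)$ into $k$ parts and a strongly consistent ordering in which each part is consecutive. An ordering of $V(H)$ is proper canonical if for all $p$ before $q$ before $r$, $(p,r)\in E(H)$ implies $(p,q),(q,r)\in E(H)$. For a bipartition $(A,B)$ of $V(G)$, $S_G(A,B)$ is the split graph obtained from $G$ by adding all edges between vertices of $A$ and removing all edges between vertices of $B$. An ordering of $A$ is a threshold ordering of $S_G(A,B)$ if whenever $u$ precedes $v$ in it, $N[u]\subseteq N[v]$ in $S_G(A,B)$; an ordering of $B$ is a threshold ordering of $S_G(A,B)$ if whenever $u$ precedes $v$, $N(u)\subseteq N(v)$ in $S_G(A,B)$. The pair $(s_1,s_2)$ is strongly in accordance with $G$ if $s_1$ and $s_2$ are proper canonical orderings of $G[V(s_1)]$ and $G[V(s_2)]$ respectively, and both $s_1$ and the reversal $\bar{s_2}$ of $s_2$ are threshold orderings of $S_G(V(s_1),V(s_2))$.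 -}

module Defs where

open import Data.Nat using (ℕ)
open import Data.Fin using (Fin)
open import Data.List using (List; []; _∷_; _++_; reverse)
open import Data.List.Membership.Propositional using (_∈_)
open import Data.List.Relation.Unary.Unique.Propositional using (Unique)
import Data.List.Relation.Binary.Sublist.Propositional as SL
open import Data.Product using (Σ; _×_; ∃; ∃-syntax)
open import Data.Sum using (_⊎_)
open import Data.Empty using (⊥)
open import Relation.Nullary using (¬_)
open import Relation.Binary.PropositionalEquality using (_≡_; _≢_)

record Graph (n : ℕ) : Set₁ where
  field
    E     : Fin n → Fin n → Set
    sym   : ∀ {u v} → E u v → E v u
    irrefl : ∀ {u} → ¬ E u u
open Graph public

IsOrderingOfV : ∀ {n} → List (Fin n) → Set
IsOrderingOfV {n} s = Unique s × (∀ (v : Fin n) → v ∈ s)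

Before : ∀ {n} → List (Fin n) → Fin n → Fin n → Set
Before s p q = (p ∷ q ∷ []) SL.⊆ s

Before3 : ∀ {n} → List (Fin n) → Fin n → Fin n → Fin n → Set
Before3 s p q r = (p ∷ q ∷ r ∷ []) SL.⊆ s

-- A partition is described by its "same part" relation Same.
Consistent : ∀ {n} → Graph n → (Fin n → Fin n → Set) → List (Fin n) → Set
Consistent G Same s = ∀ p q r → Before3 s p q r →
  Same p q → E G p r → E G q r

StronglyConsistent : ∀ {n} → Graph n → (Fin n → Fin n → Set) → List (Fin n) → Set
StronglyConsistent G Same s = Consistent G Same s ×
  (∀ p q r → Before3 s p q r → Same q r → E G p r → E G p q)

-- Partition of V(G) into k (possibly empty) parts, given by a labelling.
SamePart : ∀ {n k} → (Fin n → Fin k) → Fin n → Fin n → Set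
SamePart part u v = part u ≡ part v

PartsConsecutive : ∀ {n k} → (Fin n → Fin k) → List (Fin n) → Set
PartsConsecutive part s = ∀ p q r → Before3 s p q r → part p ≡ part r → part q ≡ part p

PrecedenceProperThin : ∀ {n} → Graph n → ℕ → Set
PrecedenceProperThin {n} G k = Σ (Fin n → Fin k) λ part → Σ (List (Fin n)) λ s →
  IsOrderingOfV s × StronglyConsistent G (SamePart part) s × PartsConsecutive part s

ProperCanonical : ∀ {n} → Graph n → List (Fin n) → Set
ProperCanonical G s = ∀ p q r → Before3 s p q r → E G p r → E G p q × E G q r

-- Edges of the split graph S_G(A,B), A = V(s₁), B = V(s₂):
-- add all edges within A, remove all edges within B.
SplitE : ∀ {n} → Graph n → List (Fin n) → List (Fin n) → Fin n → Fin n → Set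
SplitE G A B u v = u ≢ v × ((u ∈ A × v ∈ A) ⊎ (E G u v × ¬ (u ∈ B × v ∈ B)))

-- threshold ordering of the A-side: closed neighbourhoods increase
ThresholdA : ∀ {n} → Graph n → List (Fin n) → List (Fin n) → List (Fin n) → Set
ThresholdA G A B t = ∀ u v → Before t u v →
  ∀ w → (w ≡ u ⊎ SplitE G A B u w) → (w ≡ v ⊎ SplitE G A B v w)

-- threshold ordering of the B-side: open neighbourhoods increase
ThresholdB : ∀ {n} → Graph n → List (Fin n) → List (Fin n) → List (Fin n) → Set
ThresholdB G A B t = ∀ u v → Before t u v →
  ∀ w → SplitE G A B u w → SplitE G A B v w

StronglyInAccordance : ∀ {n} → Graph n → List (Fin n) → List (Fin n) → Set
StronglyInAccordance G s₁ s₂ =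
  ProperCanonical G s₁ × ProperCanonical G s₂ ×
  ThresholdA G s₁ s₂ s₁ × ThresholdB G s₁ s₂ (reverse s₂)

SameSide : ∀ {n} → List (Fin n) → List (Fin n) → Fin n → Fin n → Set
SameSide s₁ s₂ u v = (u ∈ s₁ × v ∈ s₁) ⊎ (u ∈ s₂ × v ∈ s₂)

module Submission where

-- A 2-labelling of V(G) whose parts are consecutive in an ordering s is the
-- same thing as writing s = s₁ ++ s₂ with each block inside one part; under
-- this translation "strongly consistent with the labelling" and "strongly
-- consistent with the bipartition (V(s₁), V(s₂))" coincide, since strong
-- consistency is antitone in the same-part relation.  The remaining content
-- is that strong consistency with the bipartition already forces (s₁, s₂) to
-- be strongly in accordance with G: each block is proper canonical (both
-- consistency rules applied inside one block), s₁ is a threshold ordering of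
-- the split graph by the first rule (vertices later in s₁ see more of s₂),
-- and the reversal of s₂ is one by the second rule (vertices earlier in s₂
-- are seen by more of s₁).

open import Defs
open import Data.Nat using (ℕ)
open import Data.Fin using (Fin; zero; suc; _≟_)
open import Data.List using (List; []; _∷_; _++_; reverse; takeWhile; dropWhile)
open import Data.List.Properties using (takeWhile++dropWhile)
open import Data.List.Membership.Propositional using (_∈_)
open import Data.List.Membership.Propositional.Properties using (∈-++⁺ʳ; ∈-++⁻)
open import Data.List.Relation.Unary.Any using (here; there; any?)
open import Data.List.Relation.Unary.All using (All; []; _∷_; lookup; tabulate)
open import Data.List.Relation.Unary.All.Properties using (all-takeWhile)
open import Data.List.Relation.Unary.AllPairs using (_∷_)
open import Data.List.Relation.Unary.Unique.Propositional using (Unique)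
open import Data.List.Relation.Binary.Sublist.Propositional
  using (_⊆_; []; _∷_; _∷ʳ_; from∈; ⊆-refl; ⊆-trans)
open import Data.List.Relation.Binary.Sublist.Propositional.Properties
  using (∷ˡ⁻; ++⁺; ++⁺ˡ; ++⁺ʳ; reverse⁻) renaming (Any-resp-⊆ to ∈-⊆)
open import Data.Product using (Σ; _×_; _,_; proj₁; proj₂)
open import Data.Sum using (_⊎_; inj₁; inj₂)
open import Data.Empty using (⊥; ⊥-elim)
open import Function.Bundles using (_⇔_; mk⇔)
open import Relation.Nullary using (Dec; yes; no)
open import Relation.Binary.PropositionalEquality using (_≡_; _≢_; refl; trans; cong)
  renaming (sym to ≡-sym)

private
  variable
    A : Set
    n : ℕ

members₃ : ∀ {p q r : A} {s} → (p ∷ q ∷ r ∷ []) ⊆ s → p ∈ s × q ∈ s × r ∈ s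
members₃ σ = ∈-⊆ σ (here refl) , ∈-⊆ σ (there (here refl)) , ∈-⊆ σ (there (there (here refl)))

before₁₂ : ∀ {p q r : A} {s} → (p ∷ q ∷ r ∷ []) ⊆ s → (p ∷ q ∷ []) ⊆ s
before₁₂ σ = ⊆-trans (refl ∷ refl ∷ _ ∷ʳ []) σ

before⇒≢ : ∀ {u v : A} {t} → Unique t → (u ∷ v ∷ []) ⊆ t → u ≢ v
before⇒≢ (_ ∷ uniq) (_ ∷ʳ σ) = before⇒≢ uniq σ
before⇒≢ (u∉t ∷ _) (refl ∷ σ) refl = lookup u∉t (∈-⊆ σ (here refl)) refl

++-disjoint : ∀ (xs : List A) {ys x} → Unique (xs ++ ys) → x ∈ xs → x ∈ ys → ⊥
++-disjoint (_ ∷ xs) (x∉ ∷ _) (here refl) x∈ys = lookup x∉ (∈-++⁺ʳ xs x∈ys) refl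
++-disjoint (_ ∷ xs) (_ ∷ uniq) (there x∈xs) x∈ys = ++-disjoint xs uniq x∈xs x∈ys

after-suffix : ∀ (xs : List A) {ys p q} → Unique (xs ++ ys) →
  (p ∷ q ∷ []) ⊆ (xs ++ ys) → p ∈ ys → q ∈ ys
after-suffix [] _ σ _ = ∈-⊆ σ (there (here refl))
after-suffix (_ ∷ xs) (_ ∷ uniq) (_ ∷ʳ σ) p∈ys = after-suffix xs uniq σ p∈ys
after-suffix (_ ∷ xs) (p∉ ∷ _) (refl ∷ _) p∈ys = ⊥-elim (lookup p∉ (∈-++⁺ʳ xs p∈ys) refl)

before-prefix : ∀ (xs : List A) {ys p q} → Unique (xs ++ ys) →
  (p ∷ q ∷ []) ⊆ (xs ++ ys) → q ∈ xs → p ∈ xs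
before-prefix (_ ∷ xs) (_ ∷ _) (refl ∷ _) _ = here refl
before-prefix (_ ∷ xs) (x∉ ∷ _) (_ ∷ʳ σ) (here refl) = ⊥-elim (lookup x∉ (∈-⊆ σ (there (here refl))) refl)
before-prefix (_ ∷ xs) (_ ∷ uniq) (_ ∷ʳ σ) (there q∈xs) = there (before-prefix xs uniq σ q∈xs)

other-label : ∀ {a b c : Fin 2} → a ≢ c → b ≢ c → a ≡ b
other-label {zero}     {zero}     _ _ = refl
other-label {suc zero} {suc zero} _ _ = refl
other-label {zero}     {suc zero} {zero}     a≢c _ = ⊥-elim (a≢c refl)
other-label {zero}     {suc zero} {suc zero} _ b≢c = ⊥-elim (b≢c refl)
other-label {suc zero} {zero}     {zero}     _ b≢c = ⊥-elim (b≢c refl)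
other-label {suc zero} {zero}     {suc zero} a≢c _ = ⊥-elim (a≢c refl)

leftover-differs : ∀ {k} (part : Fin n → Fin k) x s → PartsConsecutive part (x ∷ s) →
  All (λ z → part z ≢ part x) (dropWhile (λ v → part v ≟ part x) s)
leftover-differs part x [] _ = []
leftover-differs part x (y ∷ s) consec with part y ≟ part x
... | yes _ = leftover-differs part x s λ p q r σ → consec p q r (⊆-trans σ (refl ∷ y ∷ʳ ⊆-refl))
... | no y≢x = y≢x ∷ tabulate λ z∈s z≡x →
  y≢x (consec x y _ (refl ∷ refl ∷ from∈ z∈s) (≡-sym z≡x))

record TwoBlocks (part : Fin n → Fin 2) (s : List (Fin n)) : Set where
  field
    first second : List (Fin n)
    concatenation : first ++ second ≡ s
    sameLabel : ∀ {p q} → SameSide first second p q → part p ≡ part q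

-- With two labels, consecutive parts mean exactly such a decomposition:
-- the first block is the longest prefix in the part of the first vertex.
twoBlocks : (part : Fin n → Fin 2) (s : List (Fin n)) → PartsConsecutive part s → TwoBlocks part s
twoBlocks part [] _ = record
  { first = [] ; second = [] ; concatenation = refl
  ; sameLabel = λ { (inj₁ (() , _)) ; (inj₂ (() , _)) } }
twoBlocks part (x ∷ s) consec = record
  { first = x ∷ takeWhile inPart s
  ; second = dropWhile inPart s
  ; concatenation = cong (x ∷_) (takeWhile++dropWhile inPart s)
  ; sameLabel = λ
    { (inj₁ (p∈ , q∈)) → trans (lookup firstLabels p∈) (≡-sym (lookup firstLabels q∈))
    ; (inj₂ (p∈ , q∈)) → other-label (lookup secondLabels p∈) (lookup secondLabels q∈) } }
  where
  inPart : (v : Fin _) → Dec (part v ≡ part x)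
  inPart v = part v ≟ part x
  firstLabels : All (λ v → part v ≡ part x) (x ∷ takeWhile inPart s)
  firstLabels = refl ∷ all-takeWhile inPart s
  secondLabels : All (λ v → part v ≢ part x) (dropWhile inPart s)
  secondLabels = leftover-differs part x s consec

stronglyConsistent-refine : ∀ {G : Graph n} {Same Same′ s} →
  (∀ {p q} → Same p q → Same′ p q) →
  StronglyConsistent G Same′ s → StronglyConsistent G Same s
stronglyConsistent-refine refines (rule₁ , rule₂) =
  (λ p q r σ same → rule₁ p q r σ (refines same)) ,
  (λ p q r σ same → rule₂ p q r σ (refines same))

block-properCanonical : ∀ {G : Graph n} {Same s t} → StronglyConsistent G Same s → t ⊆ s →
  (∀ {u v} → u ∈ t → v ∈ t → Same u v) → ProperCanonical G t
block-properCanonical (rule₁ , rule₂) t⊆s inBlock p q r σ pr with members₃ σ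
... | p∈ , q∈ , r∈ = rule₂ p q r σ′ (inBlock q∈ r∈) pr , rule₁ p q r σ′ (inBlock p∈ q∈) pr
  where
  σ′ : Before3 _ p q r
  σ′ = ⊆-trans σ t⊆s

module Bipartition (G : Graph n) (s₁ s₂ : List (Fin n)) (ordering : IsOrderingOfV (s₁ ++ s₂)) where

  uniq : Unique (s₁ ++ s₂)
  uniq = proj₁ ordering

  disjoint : ∀ {x} → x ∈ s₁ → x ∈ s₂ → ⊥
  disjoint = ++-disjoint s₁ uniq

  side : ∀ x → x ∈ s₁ ⊎ x ∈ s₂
  side x = ∈-++⁻ s₁ (proj₂ ordering x)

  Split : Fin n → Fin n → Set
  Split = SplitE G s₁ s₂

  blocks-properCanonical : StronglyConsistent G (SameSide s₁ s₂) (s₁ ++ s₂) →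
    ProperCanonical G s₁ × ProperCanonical G s₂
  blocks-properCanonical consistent =
    block-properCanonical {G = G} consistent (++⁺ʳ s₂ ⊆-refl) (λ u∈ v∈ → inj₁ (u∈ , v∈)) ,
    block-properCanonical {G = G} consistent (++⁺ˡ s₁ ⊆-refl) (λ u∈ v∈ → inj₂ (u∈ , v∈))

  -- Closed neighbourhoods in the split graph grow along s₁: within s₁ the
  -- split graph is complete, and a later vertex of s₁ inherits the edges of an
  -- earlier one into s₂ by the first consistency rule.
  threshold₁ : Consistent G (SameSide s₁ s₂) (s₁ ++ s₂) → ThresholdA G s₁ s₂ s₁
  threshold₁ rule₁ u v u<v w = grow
    where
    u∈ : u ∈ s₁
    u∈ = ∈-⊆ u<v (here refl)
    v∈ : v ∈ s₁
    v∈ = ∈-⊆ u<v (there (here refl))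

    clique : w ∈ s₁ → w ≡ v ⊎ Split v w
    clique w∈ with w ≟ v
    ... | yes w≡v = inj₁ w≡v
    ... | no w≢v = inj₂ ((λ v≡w → w≢v (≡-sym v≡w)) , inj₁ (v∈ , w∈))

    grow : w ≡ u ⊎ Split u w → w ≡ v ⊎ Split v w
    grow (inj₁ refl) = inj₂ ((λ v≡u → before⇒≢ uniq (++⁺ʳ s₂ u<v) (≡-sym v≡u)) , inj₁ (v∈ , u∈))
    grow (inj₂ (_ , inj₁ (_ , w∈))) = clique w∈
    grow (inj₂ (_ , inj₂ (uw , _))) with side w
    ... | inj₁ w∈ = clique w∈
    ... | inj₂ w∈ = inj₂ ((λ { refl → disjoint v∈ w∈ }) ,
      inj₂ (rule₁ u v w (++⁺ u<v (from∈ w∈)) (inj₁ (u∈ , v∈)) uw , λ (v∈₂ , _) → disjoint v∈ v∈₂))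

  -- Open neighbourhoods in the split graph grow along the reversal of s₂:
  -- s₂ is independent there, and an earlier vertex of s₂ inherits the edges
  -- from s₁ of a later one by the second consistency rule.
  threshold₂ : (∀ p q r → Before3 (s₁ ++ s₂) p q r → SameSide s₁ s₂ q r → E G p r → E G p q) →
    ThresholdB G s₁ s₂ (reverse s₂)
  threshold₂ rule₂ u v u<v w = grow
    where
    v<u : (v ∷ u ∷ []) ⊆ s₂
    v<u = reverse⁻ u<v
    v∈ : v ∈ s₂
    v∈ = ∈-⊆ v<u (here refl)
    u∈ : u ∈ s₂
    u∈ = ∈-⊆ v<u (there (here refl))

    grow : Split u w → Split v w
    grow (_ , inj₁ (u∈₁ , _)) = ⊥-elim (disjoint u∈₁ u∈)
    grow (_ , inj₂ (uw , notBoth₂)) with side w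
    ... | inj₂ w∈ = ⊥-elim (notBoth₂ (u∈ , w∈))
    ... | inj₁ w∈ = (λ { refl → disjoint w∈ v∈ }) ,
      inj₂ (Graph.sym G (rule₂ w v u (++⁺ (from∈ w∈) v<u) (inj₂ (v∈ , u∈)) (Graph.sym G uw)) ,
            λ (_ , w∈₂) → disjoint w∈ w∈₂)

  accordance : StronglyConsistent G (SameSide s₁ s₂) (s₁ ++ s₂) → StronglyInAccordance G s₁ s₂
  accordance consistent with blocks-properCanonical consistent
  ... | canonical₁ , canonical₂ =
    canonical₁ , canonical₂ , threshold₁ (proj₁ consistent) , threshold₂ (proj₂ consistent)

  label : Fin n → Fin 2
  label v with any? (v ≟_) s₁
  ... | yes _ = zero
  ... | no _ = suc zero

  label₁ : ∀ {v} → v ∈ s₁ → label v ≡ zero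
  label₁ {v} v∈ with any? (v ≟_) s₁
  ... | yes _ = refl
  ... | no v∉ = ⊥-elim (v∉ v∈)

  label₂ : ∀ {v} → v ∈ s₂ → label v ≡ suc zero
  label₂ {v} v∈ with any? (v ≟_) s₁
  ... | yes v∈₁ = ⊥-elim (disjoint v∈₁ v∈)
  ... | no _ = refl

  sameSide⇒sameLabel : ∀ {p q} → SameSide s₁ s₂ p q → label p ≡ label q
  sameSide⇒sameLabel (inj₁ (p∈ , q∈)) = trans (label₁ p∈) (≡-sym (label₁ q∈))
  sameSide⇒sameLabel (inj₂ (p∈ , q∈)) = trans (label₂ p∈) (≡-sym (label₂ q∈))

  sameLabel⇒sameSide : ∀ {p q} → label p ≡ label q → SameSide s₁ s₂ p q
  sameLabel⇒sameSide {p} {q} pq with side p | side q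
  ... | inj₁ p∈ | inj₁ q∈ = inj₁ (p∈ , q∈)
  ... | inj₂ p∈ | inj₂ q∈ = inj₂ (p∈ , q∈)
  ... | inj₁ p∈ | inj₂ q∈ with trans (≡-sym (label₁ p∈)) (trans pq (label₂ q∈))
  ...   | ()
  sameLabel⇒sameSide {p} {q} pq | inj₂ p∈ | inj₁ q∈ with trans (≡-sym (label₂ p∈)) (trans pq (label₁ q∈))
  ...   | ()

  -- Both blocks are consecutive: a vertex between two vertices of s₁ precedes
  -- a vertex of s₁, and one between two vertices of s₂ follows a vertex of s₂.
  label-consecutive : PartsConsecutive label (s₁ ++ s₂)
  label-consecutive p q r σ pr with sameLabel⇒sameSide pr
  ... | inj₁ (p∈ , r∈) = sameSide⇒sameLabel (inj₁ (before-prefix s₁ uniq (∷ˡ⁻ σ) r∈ , p∈))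
  ... | inj₂ (p∈ , r∈) = sameSide⇒sameLabel (inj₂ (after-suffix s₁ uniq (before₁₂ σ) p∈ , p∈))

AccordantBipartition : Graph n → Set
AccordantBipartition {n} G = Σ (List (Fin n)) λ s₁ → Σ (List (Fin n)) λ s₂ →
  IsOrderingOfV (s₁ ++ s₂) ×
  StronglyConsistent G (SameSide s₁ s₂) (s₁ ++ s₂) ×
  StronglyInAccordance G s₁ s₂

thin⇒bipartition : (G : Graph n) → PrecedenceProperThin G 2 → AccordantBipartition G
thin⇒bipartition G (part , s , ordering , consistent , consec) with twoBlocks part s consec
... | record { first = s₁ ; second = s₂ ; concatenation = refl ; sameLabel = sameLabel } =
  s₁ , s₂ , ordering , consistent′ , Bipartition.accordance G s₁ s₂ ordering consistent′
  where
  consistent′ : StronglyConsistent G (SameSide s₁ s₂) (s₁ ++ s₂)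
  consistent′ = stronglyConsistent-refine {G = G} {Same′ = SamePart part} sameLabel consistent

bipartition⇒thin : (G : Graph n) → AccordantBipartition G → PrecedenceProperThin G 2
bipartition⇒thin G (s₁ , s₂ , ordering , consistent , _) =
  label , s₁ ++ s₂ , ordering ,
  stronglyConsistent-refine {G = G} sameLabel⇒sameSide consistent , label-consecutive
  where open Bipartition G s₁ s₂ ordering

lemma4 : ∀ {n} (G : Graph n) →
    PrecedenceProperThin G 2 ⇔
      (Σ (List (Fin n)) λ s₁ → Σ (List (Fin n)) λ s₂ →
        IsOrderingOfV (s₁ ++ s₂) ×
        StronglyConsistent G (SameSide s₁ s₂) (s₁ ++ s₂) ×
        StronglyInAccordance G s₁ s₂)
lemma4 G = mk⇔ (thin⇒bipartition G) (bipartition⇒thin G)
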